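{- Let $G=(V,E)$ be a finite simple undirected graph. Construct a vertex-colored graph $G'=(V',E')$ as follows: $V'$ consists of the base vertices $V$, each with its own distinct color, together with, for every unordered pair of distinct vertices $u,v\in V$ with $(u,v)\notin E$, two additional vertices $u_v$ and $v_u$ which receive the same color, a color used by no other vertex; $E'$ consists of $E$ together with the edges $(u_v,u)$ and $(v_u,v)$ for each such non-adjacent pair. If $V$ can be partitioned into $k$ sets each inducing a complete subgraph (clique) of $G$, then the optimal value of the Minimum Colorful Components problem on $G'$ is at most $k$.
   Context: Minimum Colorful Components (MCC) problem: given a vertex-colored simple undirected graph, delete a set of edges so that every connected component of the remaining graph is colorful (no two vertices of the same color); the cost is the number of connected components of the remaining graph, to be minimized. -}

module Defs where

open import Data.Nat using (ℕ; _≤ᵇ_)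
open import Data.Fin using (Fin; toℕ)
open import Data.Bool using (Bool; true; false; T; not; if_then_else_)
open import Data.Product using (Σ; ∃; _×_; _,_)
open import Data.Sum using (_⊎_; inj₁; inj₂)
open import Data.Empty using (⊥)
open import Relation.Nullary using (¬_)
open import Relation.Binary.PropositionalEquality using (_≡_; _≢_)
open import Relation.Binary.Construct.Closure.ReflexiveTransitive using (Star)

record SimpleGraph (n : ℕ) : Set where
  field
    adj    : Fin n → Fin n → Bool
    sym    : ∀ u v → adj u v ≡ adj v u
    irrefl : ∀ u → adj u u ≡ false
open SimpleGraph public

record ColoredGraph : Set₁ where
  field
    Vtx   : Set
    Edge  : Vtx → Vtx → Set
    Color : Set
    col   : Vtx → Color
open ColoredGraph public

module _ (H : ColoredGraph) where
  Connected : (Vtx H → Vtx H → Set) → Vtx H → Vtx H → Set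
  Connected F = Star (λ x y → F x y ⊎ F y x)

  AllColorful : (Vtx H → Vtx H → Set) → Set
  AllColorful F = ∀ x y → Connected F x y → col H x ≡ col H y → x ≡ y

  AtMostComponents : (Vtx H → Vtx H → Set) → ℕ → Set
  AtMostComponents F k =
    Σ (Fin k → Vtx H) λ r → ∀ x → ∃ λ i → Connected F (r i) x

  -- The optimal value of Minimum Colorful Components on H is at most k:
  -- some set F of edges of H (the kept edges; the others are deleted)
  -- yields only colourful components, and at most k of them.
  MCC-opt≤ : ℕ → Set₁
  MCC-opt≤ k = Σ (Vtx H → Vtx H → Set) λ F →
    (∀ x y → F x y → Edge H x y) × AllColorful F × AtMostComponents F k

module Construction {n : ℕ} (G : SimpleGraph n) where
  -- base u, and for each ordered pair (u , v) of distinct non-adjacent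
  -- vertices the gadget vertex  gad u v  (= u_v in the paper).
  data V' : Set where
    base : Fin n → V'
    gad  : (u v : Fin n) → .(u ≢ v) → .(adj G u v ≡ false) → V'

  E' : V' → V' → Set
  E' (base u)      (base v)      = T (adj G u v)
  E' (gad u v _ _) (base w)      = w ≡ u
  E' (base w)      (gad u v _ _) = w ≡ u
  E' (gad _ _ _ _) (gad _ _ _ _) = ⊥

  -- Colours: each base vertex its own colour; u_v and v_u share the
  -- colour of the unordered pair {u,v} (stored in sorted order).
  Col : Set
  Col = Fin n ⊎ (Fin n × Fin n)

  col' : V' → Col
  col' (base u)      = inj₁ u
  col' (gad u v _ _) = inj₂ (if toℕ u ≤ᵇ toℕ v then (u , v) else (v , u))

  G' : ColoredGraph
  G' = record { Vtx = V' ; Edge = E' ; Color = Col ; col = col' }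

CliquePartition : {n : ℕ} → SimpleGraph n → ℕ → Set
CliquePartition {n} G k =
  Σ (Fin n → Fin k) λ p →
    (∀ i → ∃ λ u → p u ≡ i) ×
    (∀ u v → u ≢ v → p u ≡ p v → T (adj G u v))

-- Keep the edges inside each clique of the partition together with all pendant
-- edges u_v – u. The components are then the cliques, each carrying its gadget
-- vertices, so there are k of them. Base colours are unique, and the only other
-- colour clash is between u_v and v_u; these hang off u and v, which are distinct
-- and non-adjacent and hence lie in different cliques.
module Submission where

open import Defs hiding (sym)
open import Data.Nat using (ℕ; _≤ᵇ_)
open import Data.Fin using (Fin; toℕ; _≟_)
open import Data.Bool using (true; false; T; if_then_else_)
open import Data.Product using (∃; _×_; _,_)
open import Data.Sum using (_⊎_; inj₁; inj₂)
open import Data.Sum.Properties using (inj₁-injective; inj₂-injective)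
open import Data.Empty using (⊥; ⊥-elim-irr)
open import Relation.Nullary using (yes; no)
open import Relation.Binary.PropositionalEquality using (_≡_; _≢_; refl; sym; trans; cong; subst)
open import Relation.Binary.Construct.Closure.ReflexiveTransitive using (ε; _◅_; _◅◅_; fold)

Connected-preserves : (H : ColoredGraph) {A : Set} (F : Vtx H → Vtx H → Set) (f : Vtx H → A) →
  (∀ x y → F x y → f x ≡ f y) → ∀ {x y} → Connected H F x y → f x ≡ f y
Connected-preserves H F f pres path =
  fold (λ x y → f x ≡ f y) (λ step rest → trans (stepPreserves step) rest) refl path
  where
  stepPreserves : ∀ {x y} → F x y ⊎ F y x → f x ≡ f y
  stepPreserves (inj₁ e) = pres _ _ e
  stepPreserves (inj₂ e) = sym (pres _ _ e)

sortPair : {n : ℕ} → Fin n → Fin n → Fin n × Fin n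
sortPair u v = if toℕ u ≤ᵇ toℕ v then (u , v) else (v , u)

sortPair≡⇒samePair⊎swapped : {n : ℕ} {u v u′ v′ : Fin n} → sortPair u v ≡ sortPair u′ v′ →
  (u ≡ u′ × v ≡ v′) ⊎ (u ≡ v′ × v ≡ u′)
sortPair≡⇒samePair⊎swapped {u = u} {v} {u′} {v′} eq with toℕ u ≤ᵇ toℕ v | toℕ u′ ≤ᵇ toℕ v′ | eq
... | true  | true  | refl = inj₁ (refl , refl)
... | true  | false | refl = inj₂ (refl , refl)
... | false | true  | refl = inj₂ (refl , refl)
... | false | false | refl = inj₁ (refl , refl)

module _ {n k : ℕ} (G : SimpleGraph n) (block : Fin n → Fin k)
         (block-surjective : ∀ i → ∃ λ u → block u ≡ i)
         (block-clique : ∀ u v → u ≢ v → block u ≡ block v → T (adj G u v)) where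
  open Construction G

  Kept : V' → V' → Set
  Kept (base u)      (base v)      = (u ≢ v) × (block u ≡ block v)
  Kept (gad u _ _ _) (base w)      = w ≡ u
  Kept (base w)      (gad u _ _ _) = w ≡ u
  Kept (gad _ _ _ _) (gad _ _ _ _) = ⊥

  Kept⊆E' : ∀ x y → Kept x y → E' x y
  Kept⊆E' (base u)      (base v)      (u≢v , same) = block-clique u v u≢v same
  Kept⊆E' (gad _ _ _ _) (base _)      w≡u          = w≡u
  Kept⊆E' (base _)      (gad _ _ _ _) w≡u          = w≡u

  block' : V' → Fin k
  block' (base u)      = block u
  block' (gad u _ _ _) = block u

  Kept-preserves-block' : ∀ x y → Kept x y → block' x ≡ block' y
  Kept-preserves-block' (base _)      (base _)      (_ , same) = same
  Kept-preserves-block' (gad _ _ _ _) (base _)      refl       = refl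
  Kept-preserves-block' (base _)      (gad _ _ _ _) refl       = refl

  nonadjacent⇒differentBlocks : ∀ u v → u ≢ v → adj G u v ≡ false → block u ≢ block v
  nonadjacent⇒differentBlocks u v u≢v nonadj same =
    subst T nonadj (block-clique u v u≢v same)

  sameBlock⇒gad-colorful : ∀ u v u′ v′ .(u≢v : u ≢ v) .(nonadj : adj G u v ≡ false)
    .(u′≢v′ : u′ ≢ v′) .(nonadj′ : adj G u′ v′ ≡ false) →
    block u ≡ block u′ → sortPair u v ≡ sortPair u′ v′ →
    gad u v u≢v nonadj ≡ gad u′ v′ u′≢v′ nonadj′
  sameBlock⇒gad-colorful u v u′ v′ u≢v nonadj _ _ same eq with sortPair≡⇒samePair⊎swapped {u = u} eq
  ... | inj₁ (refl , refl) = refl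
  ... | inj₂ (refl , refl) = ⊥-elim-irr (nonadjacent⇒differentBlocks u v u≢v nonadj same)

  colorful : AllColorful G' Kept
  colorful (base _)      (base _)      _ eq = cong base (inj₁-injective eq)
  colorful (base _)      (gad _ _ _ _) _ ()
  colorful (gad _ _ _ _) (base _)      _ ()
  colorful (gad u v _ _) (gad u′ v′ _ _) path eq =
    sameBlock⇒gad-colorful u v u′ v′ _ _ _ _
      (Connected-preserves G' Kept block' Kept-preserves-block' path) (inj₂-injective eq)

  representative : Fin k → V'
  representative i with block-surjective i
  ... | u , _ = base u

  sameBlock⇒Connected : ∀ u v → block u ≡ block v → Connected G' Kept (base u) (base v)
  sameBlock⇒Connected u v same with u ≟ v
  ... | yes refl = ε
  ... | no u≢v   = inj₁ (u≢v , same) ◅ ε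

  reachesBase : ∀ u → Connected G' Kept (representative (block u)) (base u)
  reachesBase u with block-surjective (block u)
  ... | w , same = sameBlock⇒Connected w u same

  atMostComponents : AtMostComponents G' Kept k
  atMostComponents = representative , λ where
    (base u)      → block u , reachesBase u
    (gad u _ _ _) → block u , reachesBase u ◅◅ (inj₁ refl ◅ ε)

lemma6 : (n : ℕ) (G : SimpleGraph n) (k : ℕ) →
    CliquePartition G k → MCC-opt≤ (Construction.G' G) k
lemma6 n G k (block , block-surjective , block-clique) =
  Kept G block block-surjective block-clique ,
  Kept⊆E' G block block-surjective block-clique ,
  colorful G block block-surjective block-clique ,
  atMostComponents G block block-surjective block-clique
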